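{- Let $G\subseteq S_\omega$ be a cofinitary group (acting on $\omega$ in the natural way) which is maximal as an eventually different family of permutations, and let $F$ be a finite group. Consider the action of $G\times F$ on $\omega\times F$ given by $(g,f).(n,x)=(g(n),f x)$ (the product of the given action of $G$ on $\omega$ and the left regular action of $F$ on itself). Then this action of $G\times F$ on $\omega\times F$ is cofinitary, and the set of permutations of $\omega\times F$ induced by elements of $G\times F$ is maximal as an eventually different family of permutations of $\omega\times F$.
   Context: For a countably infinite set $Z$, $S_Z$ denotes the group of permutations of $Z$, and $S_\omega=S_{\omega}$ with $\omega=\{0,1,2,\dots\}$. A group acting on $Z$ acts cofinitarily if every non-identity element has only finitely many fixed points; a subgroup of $S_\omega$ is cofinitary if its natural action is cofinitary. Two functions $p,q$ on $Z$ are eventually different if $\{z\in Z: p(z)=q(z)\}$ is finite. A family $\mathcal{A}\subseteq S_Z$ is maximal as an eventually different family of permutations if for every $h\in S_Z$ there is $a\in\mathcal{A}$ such that $h(z)=a(z)$ for infinitely many $z\in Z$. -}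

module Defs where

open import Level using (0ℓ)
open import Data.Nat using (ℕ)
open import Data.Product using (Σ; ∃; _×_; _,_; proj₁; proj₂)
open import Data.List using (List)
open import Data.List.Membership.Propositional using (_∈_)
open import Relation.Nullary using (¬_)
open import Relation.Binary.PropositionalEquality
  using (_≡_; refl; sym; trans; cong; cong₂)
open import Function.Bundles using (_↔_; Inverse; mk↔ₛ′)
open import Algebra.Bundles using (Group)

Sym : Set → Set
Sym Z = Z ↔ Z

app : {Z : Set} → Sym Z → Z → Z
app p = Inverse.to p

IsIdentity : {Z : Set} → Sym Z → Set
IsIdentity p = ∀ z → app p z ≡ z

Finite : {Z : Set} → (Z → Set) → Set
Finite {Z} P = Σ (List Z) λ xs → ∀ z → P z → z ∈ xs

Infinite : {Z : Set} → (Z → Set) → Set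
Infinite P = ¬ Finite P

FixedPoints : {Z : Set} → (Z → Z) → Z → Set
FixedPoints f z = f z ≡ z

Agree : {Z : Set} → (Z → Z) → (Z → Z) → Z → Set
Agree p q z = p z ≡ q z

MaximalED : {Z : Set} → (Sym Z → Set) → Set
MaximalED {Z} A = ∀ (h : Sym Z) → Σ (Sym Z) λ a → A a × Infinite (Agree (app h) (app a))

record IsSubgroup {Z : Set} (G : Sym Z → Set) : Set₁ where
  field
    has-id   : Σ (Sym Z) λ e → G e × IsIdentity e
    has-comp : ∀ p q → G p → G q → Σ (Sym Z) λ r → G r × (∀ z → app r z ≡ app p (app q z))
    has-inv  : ∀ p → G p → Σ (Sym Z) λ r → G r × (∀ z → app r (app p z) ≡ z)

IsCofinitaryGroup : {Z : Set} → (Sym Z → Set) → Set₁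
IsCofinitaryGroup G = IsSubgroup G × (∀ g → G g → ¬ IsIdentity g → Finite (FixedPoints (app g)))

IsFiniteGroup : Group 0ℓ 0ℓ → Set
IsFiniteGroup F = (∀ {x y} → Group._≈_ F x y → x ≡ y)
                × Σ ℕ λ n → Group.Carrier F ↔ Data.Fin.Fin n
  where import Data.Fin

module ProductAction (F : Group 0ℓ 0ℓ) (≈⇒≡ : ∀ {x y} → Group._≈_ F x y → x ≡ y) where
  open Group F renaming (Carrier to C)

  act : Sym ℕ → C → ℕ × C → ℕ × C
  act g f (n , x) = (Inverse.to g n , f ∙ x)

  actInv : Sym ℕ → C → ℕ × C → ℕ × C
  actInv g f (n , x) = (Inverse.from g n , f ⁻¹ ∙ x)

  induced : Sym ℕ → C → Sym (ℕ × C)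
  induced g f = mk↔ₛ′ (act g f) (actInv g f)
    (λ { (n , x) → cong₂ _,_ (Inverse.strictlyInverseˡ g n)
          (≈⇒≡ (trans≈ (sym≈ (assoc f (f ⁻¹) x))
                 (trans≈ (∙-congʳ (inverseʳ f)) (identityˡ x)))) })
    (λ { (n , x) → cong₂ _,_ (Inverse.strictlyInverseʳ g n)
          (≈⇒≡ (trans≈ (sym≈ (assoc (f ⁻¹) f x))
                 (trans≈ (∙-congʳ (inverseˡ f)) (identityˡ x)))) })
    where
      open import Relation.Binary.Structures using (IsEquivalence)
      trans≈ = Group.trans F
      sym≈ = Group.sym F

{-# OPTIONS --safe #-}
module Submission where

open import Defs
open import Level using (0ℓ)
open import Data.Nat using (ℕ)
open import Data.Product using (Σ; _×_; _,_; proj₁; proj₂)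
open import Relation.Nullary using (¬_)
open import Relation.Binary.PropositionalEquality using (_≡_)
open import Algebra.Bundles using (Group)
open import Axiom.ExcludedMiddle using (ExcludedMiddle)

open import Algebra.Properties.Group using (identityˡ-unique; //-rightDividesˡ)
open import Data.Bool using (Bool; true; false; T; _∨_)
open import Data.Bool.Properties using (T-∨; T?)
open import Data.Empty using (⊥; ⊥-elim)
open import Data.Fin using (Fin)
open import Data.Fin.Properties using (nonZeroIndex)
open import Data.List using (List; []; _∷_; _++_; map; length; filter; upTo; tabulate; cartesianProduct)
open import Data.List.Membership.Propositional using (_∈_)
open import Data.List.Membership.Propositional.Properties
  using (∈-map⁺; ∈-map⁻; ∈-++⁺ˡ; ∈-++⁺ʳ; ∈-++⁻; ∈-∃++; ∈-upTo⁺; ∈-upTo⁻; ∈-filter⁺; ∈-filter⁻;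
         ∈-tabulate⁺; ∈-cartesianProduct⁺; ∈-cartesianProduct⁻)
open import Data.List.Properties using (length-++; length-map; length-tabulate)
open import Data.List.Relation.Binary.Disjoint.Propositional using (Disjoint)
import Data.List.Relation.Unary.All as All
open import Data.List.Relation.Unary.AllPairs using ([]; _∷_)
open import Data.List.Relation.Unary.Any using (here; there)
open import Data.List.Relation.Unary.Unique.Propositional using (Unique)
import Data.List.Relation.Unary.Unique.Propositional.Properties as Unique
open import Data.Nat using (zero; suc; _+_; _*_; _≤_; _<_; _⊔_; _≟_; _≡ᵇ_; z≤n; s≤s; s≤s⁻¹)
open import Data.Nat.Properties
open import Data.Product using (∃; ∃₂; map₁)
open import Data.Sum using (_⊎_; inj₁; inj₂; [_,_]′)
import Data.Sum as Sum
open import Data.Unit using (tt)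
open import Function using (_∘_; Equivalence; Injection; _↔_; Inverse; mk↔ₛ′)
open import Function.Properties.Inverse using (↔⇒↣; ↔-sym)
open import Relation.Binary.PropositionalEquality
  using (refl; sym; trans; cong; cong₂; subst; _≢_; module ≡-Reasoning)
open import Relation.Nullary using (yes; no; contradiction)
open import Relation.Nullary.Decidable using (decidable-stable)
open import Relation.Unary using (Pred; _⊆_; _∪_; _∖_; ｛_｝; U; Satisfiable)

-- Write s = |F|, and for S ⊆ ω let N(S) be the set of m such that a permutation h of ω × F
-- maps some (n , x) with n ∈ S into {m} × F. Since h is injective, s |S| ≤ s |N(S)|, so
-- Hall's theorem on initial segments, followed by a compactness argument, gives an injection
-- c : ω → ω with c n ∈ N({n}). Splitting the c-chains that have a first element into
-- consecutive pairs turns c into a permutation σ with σ n ∈ N({n}) or n ∈ N({σ n}) for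
-- every n. By maximality some a ∈ G agrees with σ infinitely often, and the pigeonhole
-- principle yields x , y ∈ F with h (m , x) = (a m , y) for infinitely many m, or with
-- h (a m , x) = (m , y) for infinitely many m. Then (a , y x⁻¹), respectively (a⁻¹ , y x⁻¹),
-- agrees with h infinitely often. Cofinitarity is immediate: (g , f) fixes (n , x) only if
-- g n = n and f = 1.

unique-⊆⇒length≤ : {A : Set} {xs ys : List A} → Unique xs → (∀ {x} → x ∈ xs → x ∈ ys) →
                    length xs ≤ length ys
unique-⊆⇒length≤ {xs = []} _ _ = z≤n
unique-⊆⇒length≤ {xs = x ∷ xs} (x∉xs ∷ xs-unique) xs⊆ys with ∈-∃++ (xs⊆ys (here refl))
... | ys₁ , ys₂ , refl = begin
  suc (length xs)                ≤⟨ s≤s (unique-⊆⇒length≤ xs-unique xs⊆ys₁++ys₂) ⟩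
  suc (length (ys₁ ++ ys₂))      ≡⟨ cong suc (length-++ ys₁) ⟩
  suc (length ys₁ + length ys₂)  ≡⟨ +-suc (length ys₁) (length ys₂) ⟨
  length ys₁ + suc (length ys₂)  ≡⟨ length-++ ys₁ ⟨
  length (ys₁ ++ x ∷ ys₂)        ∎
  where
  open ≤-Reasoning
  xs⊆ys₁++ys₂ : ∀ {z} → z ∈ xs → z ∈ ys₁ ++ ys₂
  xs⊆ys₁++ys₂ z∈xs with ∈-++⁻ ys₁ (xs⊆ys (there z∈xs))
  ... | inj₁ z∈ys₁         = ∈-++⁺ˡ z∈ys₁
  ... | inj₂ (here refl)   = contradiction refl (All.lookup x∉xs z∈xs)
  ... | inj₂ (there z∈ys₂) = ∈-++⁺ʳ ys₁ z∈ys₂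

length>0⇒∃∈ : {A : Set} {xs : List A} → 0 < length xs → ∃ λ x → x ∈ xs
length>0⇒∃∈ {xs = x ∷ _} _ = x , here refl

length-cartesianProduct : {A B : Set} (xs : List A) (ys : List B) →
                          length (cartesianProduct xs ys) ≡ length xs * length ys
length-cartesianProduct [] ys = refl
length-cartesianProduct (x ∷ xs) ys = begin
  length (map (x ,_) ys ++ cartesianProduct xs ys)            ≡⟨ length-++ (map (x ,_) ys) ⟩
  length (map (x ,_) ys) + length (cartesianProduct xs ys)
    ≡⟨ cong₂ _+_ (length-map (x ,_) ys) (length-cartesianProduct xs ys) ⟩
  length ys + length xs * length ys                          ∎
  where open ≡-Reasoning

common-bound : {X : Set} (Q : X → ℕ → Set) → (∀ {x m n} → m ≤ n → Q x m → Q x n) →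
               (xs : List X) → (∀ x → ∃ (Q x)) → ∃ λ n → ∀ {x} → x ∈ xs → Q x n
common-bound Q Q-mono [] _ = 0 , λ ()
common-bound Q Q-mono (x ∷ xs) bound with bound x | common-bound Q Q-mono xs bound
... | m , Qxm | n , Qxsn = m ⊔ n , λ where
  (here refl)   → Q-mono (m≤m⊔n m n) Qxm
  (there x∈xs) → Q-mono (m≤n⊔m m n) (Qxsn x∈xs)

module Enumeration {C : Set} {s : ℕ} (enum : C ↔ Fin s) where
  open Inverse enum

  elements : List C
  elements = tabulate from

  ∈-elements : ∀ x → x ∈ elements
  ∈-elements x = subst (_∈ elements) (strictlyInverseʳ x) (∈-tabulate⁺ (to x))

  elements-unique : Unique elements
  elements-unique = Unique.tabulate⁺ (Injection.injective (↔⇒↣ (↔-sym enum)))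

  length-elements : length elements ≡ s
  length-elements = length-tabulate from

finite-⊆ : {Z : Set} {P Q : Pred Z 0ℓ} → P ⊆ Q → Finite Q → Finite P
finite-⊆ P⊆Q (xs , Q⊆xs) = xs , λ z Pz → Q⊆xs z (P⊆Q Pz)

finite-⊆-image : {Y Z : Set} {P : Pred Z 0ℓ} {Q : Pred Y 0ℓ} (f : Y → Z) →
                 (∀ {z} → P z → ∃ λ y → Q y × f y ≡ z) → Finite Q → Finite P
finite-⊆-image {P = P} f P⊆f[Q] (ys , Q⊆ys) = map f ys , P⊆f[ys]
  where
  P⊆f[ys] : ∀ z → P z → z ∈ map f ys
  P⊆f[ys] z Pz with P⊆f[Q] Pz
  ... | y , Qy , refl = ∈-map⁺ f (Q⊆ys y Qy)

finite-⋃ : {Z K : Set} (Q : K → Pred Z 0ℓ) (ks : List K) → (∀ {κ} → κ ∈ ks → Finite (Q κ)) →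
           Finite (λ z → ∃ λ κ → κ ∈ ks × Q κ z)
finite-⋃ Q [] _ = [] , λ { _ (_ , () , _) }
finite-⋃ Q (κ ∷ ks) Q-finite = proj₁ Qκ-finite ++ proj₁ rest-finite , cover
  where
  Qκ-finite : Finite (Q κ)
  Qκ-finite = Q-finite (here refl)
  rest-finite : Finite (λ z → ∃ λ κ′ → κ′ ∈ ks × Q κ′ z)
  rest-finite = finite-⋃ Q ks (λ κ′∈ks → Q-finite (there κ′∈ks))
  cover : ∀ z → (∃ λ κ′ → κ′ ∈ κ ∷ ks × Q κ′ z) → z ∈ proj₁ Qκ-finite ++ proj₁ rest-finite
  cover z (_ , here refl , Qz)        = ∈-++⁺ˡ (proj₂ Qκ-finite z Qz)
  cover z (κ′ , there κ′∈ks , Qz) = ∈-++⁺ʳ _ (proj₂ rest-finite z (κ′ , κ′∈ks , Qz))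

infinite-pigeonhole : ExcludedMiddle 0ℓ → {Z K : Set} {P : Pred Z 0ℓ} (Q : K → Pred Z 0ℓ) (ks : List K) →
                      (∀ {z} → P z → ∃ λ κ → κ ∈ ks × Q κ z) → Infinite P → ∃ λ κ → Infinite (Q κ)
infinite-pigeonhole em Q ks P⊆⋃Q P-infinite with em {∃ λ κ → Infinite (Q κ)}
... | yes found = found
... | no none = ⊥-elim (P-infinite (finite-⊆ P⊆⋃Q (finite-⋃ Q ks Q-finite)))
  where
  Q-finite : ∀ {κ} → κ ∈ ks → Finite (Q κ)
  Q-finite {κ} _ = decidable-stable em (λ Qκ-infinite → none (κ , Qκ-infinite))

module Counting (em : ExcludedMiddle 0ℓ) where

  -- Opaque, so that count n P is rigid and unification never unfolds the filter over em.
  opaque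
    elementsBelow : ℕ → Pred ℕ 0ℓ → List ℕ
    elementsBelow n P = filter (λ v → em {P v}) (upTo n)

    ∈-elementsBelow⁺ : ∀ {n P v} → v < n → P v → v ∈ elementsBelow n P
    ∈-elementsBelow⁺ {P = P} v<n Pv = ∈-filter⁺ (λ v → em {P v}) (∈-upTo⁺ v<n) Pv

    ∈-elementsBelow⁻ : ∀ {n P v} → v ∈ elementsBelow n P → v < n × P v
    ∈-elementsBelow⁻ {P = P} v∈ = map₁ ∈-upTo⁻ (∈-filter⁻ (λ v → em {P v}) v∈)

    elementsBelow-unique : ∀ n P → Unique (elementsBelow n P)
    elementsBelow-unique n P = Unique.filter⁺ (λ v → em {P v}) (Unique.upTo⁺ n)

  count : ℕ → Pred ℕ 0ℓ → ℕ
  count n P = length (elementsBelow n P)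

  count-mono : ∀ {n P Q} → P ⊆ Q → count n P ≤ count n Q
  count-mono {n} {P} P⊆Q = unique-⊆⇒length≤ (elementsBelow-unique n P) λ v∈P →
    let v<n , Pv = ∈-elementsBelow⁻ v∈P in ∈-elementsBelow⁺ v<n (P⊆Q Pv)

  count-∪ : ∀ n {P Q} → count n (P ∪ Q) ≤ count n P + count n Q
  count-∪ n {P} {Q} = ≤-trans (unique-⊆⇒length≤ (elementsBelow-unique n (P ∪ Q)) split)
                              (≤-reflexive (length-++ (elementsBelow n P)))
    where
    split : ∀ {v} → v ∈ elementsBelow n (P ∪ Q) → v ∈ elementsBelow n P ++ elementsBelow n Q
    split v∈ with ∈-elementsBelow⁻ {P = P ∪ Q} v∈
    ... | v<n , inj₁ Pv = ∈-++⁺ˡ (∈-elementsBelow⁺ v<n Pv)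
    ... | v<n , inj₂ Qv = ∈-++⁺ʳ _ (∈-elementsBelow⁺ v<n Qv)

  count-disjoint-∪ : ∀ n {P Q} → (∀ {v} → P v → Q v → ⊥) → count n P + count n Q ≤ count n (P ∪ Q)
  count-disjoint-∪ n {P} {Q} P∩Q≡∅ = subst (_≤ count n (P ∪ Q)) (length-++ (elementsBelow n P))
    (unique-⊆⇒length≤ (Unique.++⁺ (elementsBelow-unique n P) (elementsBelow-unique n Q) disjoint) merge)
    where
    disjoint : Disjoint (elementsBelow n P) (elementsBelow n Q)
    disjoint (v∈P , v∈Q) = P∩Q≡∅ (proj₂ (∈-elementsBelow⁻ v∈P)) (proj₂ (∈-elementsBelow⁻ v∈Q))
    merge : ∀ {v} → v ∈ elementsBelow n P ++ elementsBelow n Q → v ∈ elementsBelow n (P ∪ Q)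
    merge v∈ with ∈-++⁻ (elementsBelow n P) v∈
    ... | inj₁ v∈P = let v<n , Pv = ∈-elementsBelow⁻ v∈P in ∈-elementsBelow⁺ v<n (inj₁ Pv)
    ... | inj₂ v∈Q = let v<n , Qv = ∈-elementsBelow⁻ v∈Q in ∈-elementsBelow⁺ v<n (inj₂ Qv)

  count-singleton : ∀ n u → count n ｛ u ｝ ≤ 1
  count-singleton n u = unique-⊆⇒length≤ {ys = u ∷ []} (elementsBelow-unique n ｛ u ｝) λ v∈ →
    here (sym (proj₂ (∈-elementsBelow⁻ v∈)))

  count-pos : ∀ {n P v} → v < n → P v → 0 < count n P
  count-pos v<n Pv = unique-⊆⇒length≤ (All.[] ∷ []) λ { (here refl) → ∈-elementsBelow⁺ v<n Pv }

  count-witness : ∀ {n P} → 0 < count n P → ∃ λ v → v < n × P v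
  count-witness {n} {P} count>0 =
    let v , v∈ = length>0⇒∃∈ {xs = elementsBelow n P} count>0 in v , ∈-elementsBelow⁻ {n} {P} v∈

  count-⊂ : ∀ {n P Q u} → P ⊆ Q → u < n → Q u → ¬ P u → count n P < count n Q
  count-⊂ {n} {P} {Q} {u} P⊆Q u<n Qu ¬Pu = begin-strict
    count n P                    <⟨ m<m+n (count n P) (count-pos {P = ｛ u ｝} u<n refl) ⟩
    count n P + count n ｛ u ｝   ≤⟨ count-disjoint-∪ n (λ { Pv refl → ¬Pu Pv }) ⟩
    count n (P ∪ ｛ u ｝)         ≤⟨ count-mono (λ { (inj₁ Pv) → P⊆Q Pv ; (inj₂ refl) → Qu }) ⟩
    count n Q                    ∎
    where open ≤-Reasoning

-- Hall's marriage theorem for a bipartite graph on ℕ ⊎ ℕ in which left vertex v is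
-- adjacent to e v x for each x : C. Sets are counted below M: left sets must be
-- Bounded, while neighbours beyond M are ignored, which only strengthens HallCondition.
module Hall (em : ExcludedMiddle 0ℓ) {C : Set} (x₀ : C) (e : ℕ → C → ℕ) (M : ℕ) where
  open Counting em

  ∣_∣ : Pred ℕ 0ℓ → ℕ
  ∣ P ∣ = count M P

  N[_] : Pred ℕ 0ℓ → Pred ℕ 0ℓ → Pred ℕ 0ℓ
  N[ A ] S w = A w × ∃₂ λ v x → S v × e v x ≡ w

  Bounded : Pred ℕ 0ℓ → Set
  Bounded L = L ⊆ (_< M)

  record Matching (L A : Pred ℕ 0ℓ) : Set where
    field
      choice    : ℕ → C
      lands     : ∀ {v} → L v → A (e v (choice v))
      injective : ∀ {v v′} → L v → L v′ → e v (choice v) ≡ e v′ (choice v′) → v ≡ v′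

  open Matching

  matching-empty : ∀ {L A} → (∀ {v} → ¬ L v) → Matching L A
  matching-empty ¬L = record
    { choice = λ _ → x₀ ; lands = λ Lv → ⊥-elim (¬L Lv) ; injective = λ Lv _ _ → ⊥-elim (¬L Lv) }

  matching-singleton : ∀ u x → Matching ｛ u ｝ ｛ e u x ｝
  matching-singleton u x = record
    { choice = λ _ → x ; lands = λ { refl → refl } ; injective = λ { refl refl _ → refl } }

  matching-mono : ∀ {L L′ A A′} → L ⊆ L′ → A′ ⊆ A → Matching L′ A′ → Matching L A
  matching-mono L⊆L′ A′⊆A m = record
    { choice    = choice m
    ; lands     = λ Lv → A′⊆A (lands m (L⊆L′ Lv))
    ; injective = λ Lv Lv′ → injective m (L⊆L′ Lv) (L⊆L′ Lv′)
    }

  matching-into-N : ∀ {S A} → Matching S A → Matching S (N[ A ] S)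
  matching-into-N m = record
    { choice    = choice m
    ; lands     = λ {v} Sv → lands m Sv , v , choice m v , Sv , refl
    ; injective = injective m
    }

  matching-∪ : ∀ {L₁ L₂ A₁ A₂} → (∀ {w} → A₁ w → A₂ w → ⊥) →
               Matching L₁ A₁ → Matching L₂ A₂ → Matching (L₁ ∪ L₂) (A₁ ∪ A₂)
  matching-∪ {L₁} {L₂} {A₁} {A₂} A₁∩A₂≡∅ m₁ m₂ =
    record { choice = c ; lands = lands′ ; injective = injective′ }
    where
    c : ℕ → C
    c v with em {L₁ v}
    ... | yes _ = choice m₁ v
    ... | no _  = choice m₂ v

    lands′ : ∀ {v} → (L₁ ∪ L₂) v → (A₁ ∪ A₂) (e v (c v))
    lands′ {v} L₁₂v with em {L₁ v} | L₁₂v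
    ... | yes L₁v | _        = inj₁ (lands m₁ L₁v)
    ... | no ¬L₁v | inj₁ L₁v = contradiction L₁v ¬L₁v
    ... | no _    | inj₂ L₂v = inj₂ (lands m₂ L₂v)

    only-L₂ : ∀ {v} → (L₁ ∪ L₂) v → ¬ L₁ v → L₂ v
    only-L₂ L₁₂v ¬L₁v = [ (λ L₁v → contradiction L₁v ¬L₁v) , (λ L₂v → L₂v) ]′ L₁₂v

    injective′ : ∀ {v v′} → (L₁ ∪ L₂) v → (L₁ ∪ L₂) v′ → e v (c v) ≡ e v′ (c v′) → v ≡ v′
    injective′ {v} {v′} L₁₂v L₁₂v′ eq with em {L₁ v} | em {L₁ v′}
    ... | yes L₁v | yes L₁v′ = injective m₁ L₁v L₁v′ eq
    ... | no ¬L₁v | no ¬L₁v′ = injective m₂ (only-L₂ L₁₂v ¬L₁v) (only-L₂ L₁₂v′ ¬L₁v′) eq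
    ... | yes L₁v | no ¬L₁v′ =
      ⊥-elim (A₁∩A₂≡∅ (lands m₁ L₁v) (subst A₂ (sym eq) (lands m₂ (only-L₂ L₁₂v′ ¬L₁v′))))
    ... | no ¬L₁v | yes L₁v′ =
      ⊥-elim (A₁∩A₂≡∅ (lands m₁ L₁v′) (subst A₂ eq (lands m₂ (only-L₂ L₁₂v ¬L₁v))))

  ⟦_⟧ : (ℕ → Bool) → Pred ℕ 0ℓ
  ⟦ S ⟧ v = T (S v)

  -- Subsets of the left side range over characteristic functions, so that
  -- HallCondition and Critical are small types that em can decide.
  HallCondition : Pred ℕ 0ℓ → Pred ℕ 0ℓ → Set
  HallCondition L A = ∀ S → ⟦ S ⟧ ⊆ L → ∣ ⟦ S ⟧ ∣ ≤ ∣ N[ A ] ⟦ S ⟧ ∣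

  Critical : Pred ℕ 0ℓ → Pred ℕ 0ℓ → Set
  Critical L A = ∃ λ S → ⟦ S ⟧ ⊆ L × 0 < ∣ ⟦ S ⟧ ∣ × ∣ ⟦ S ⟧ ∣ < ∣ L ∣ × ∣ N[ A ] ⟦ S ⟧ ∣ ≤ ∣ ⟦ S ⟧ ∣

  hall-condition-⊆ : ∀ {L L′ A} → L′ ⊆ L → HallCondition L A → HallCondition L′ A
  hall-condition-⊆ L′⊆L hallLA S S⊆L′ = hallLA S (λ Sv → L′⊆L (S⊆L′ Sv))

  hall-condition-off-critical : ∀ {L A} S → HallCondition L A → ⟦ S ⟧ ⊆ L → ∣ N[ A ] ⟦ S ⟧ ∣ ≤ ∣ ⟦ S ⟧ ∣ →
                                HallCondition (L ∖ ⟦ S ⟧) (A ∖ N[ A ] ⟦ S ⟧)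
  hall-condition-off-critical {L} {A} S hallLA S⊆L tight R R⊆L∖S = +-cancelʳ-≤ ∣ ⟦ S ⟧ ∣ _ _ (begin
    ∣ ⟦ R ⟧ ∣ + ∣ ⟦ S ⟧ ∣                         ≤⟨ count-disjoint-∪ M (λ Rv Sv → proj₂ (R⊆L∖S Rv) Sv) ⟩
    ∣ ⟦ R ⟧ ∪ ⟦ S ⟧ ∣                              ≤⟨ count-mono (λ {v} → Equivalence.from (T-∨ {R v} {S v})) ⟩
    ∣ ⟦ R∪S ⟧ ∣                                    ≤⟨ hallLA R∪S R∪S⊆L ⟩
    ∣ N[ A ] ⟦ R∪S ⟧ ∣                             ≤⟨ count-mono split ⟩
    ∣ N[ A ∖ N[ A ] ⟦ S ⟧ ] ⟦ R ⟧ ∪ N[ A ] ⟦ S ⟧ ∣    ≤⟨ count-∪ M ⟩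
    ∣ N[ A ∖ N[ A ] ⟦ S ⟧ ] ⟦ R ⟧ ∣ + ∣ N[ A ] ⟦ S ⟧ ∣ ≤⟨ +-monoʳ-≤ _ tight ⟩
    ∣ N[ A ∖ N[ A ] ⟦ S ⟧ ] ⟦ R ⟧ ∣ + ∣ ⟦ S ⟧ ∣       ∎)
    where
    open ≤-Reasoning
    R∪S : ℕ → Bool
    R∪S v = R v ∨ S v
    R∪S⊆L : ⟦ R∪S ⟧ ⊆ L
    R∪S⊆L {v} RSv = [ (λ Rv → proj₁ (R⊆L∖S Rv)) , S⊆L ]′ (Equivalence.to (T-∨ {R v} {S v}) RSv)
    split : N[ A ] ⟦ R∪S ⟧ ⊆ N[ A ∖ N[ A ] ⟦ S ⟧ ] ⟦ R ⟧ ∪ N[ A ] ⟦ S ⟧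
    split {w} (Aw , v , x , RSv , evx≡w) with em {N[ A ] ⟦ S ⟧ w} | Equivalence.to (T-∨ {R v} {S v}) RSv
    ... | yes NSw | _       = inj₂ NSw
    ... | no ¬NSw | inj₁ Rv = inj₁ ((Aw , ¬NSw) , v , x , Rv , evx≡w)
    ... | no _    | inj₂ Sv = inj₂ (Aw , v , x , Sv , evx≡w)

  hall-condition-off-point : ∀ {L A u} w → HallCondition L A → ¬ Critical L A → L u → u < M →
                             HallCondition (L ∖ ｛ u ｝) (A ∖ ｛ w ｝)
  hall-condition-off-point {L} {A} {u} w hallLA ¬critical Lu u<M R R⊆L-u with ∣ ⟦ R ⟧ ∣ ≟ 0
  ... | yes ∣R∣≡0 = ≤-trans (≤-reflexive ∣R∣≡0) z≤n
  ... | no ∣R∣≢0 = s≤s⁻¹ (begin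
    suc ∣ ⟦ R ⟧ ∣                          ≤⟨ ≰⇒> loose ⟩
    ∣ N[ A ] ⟦ R ⟧ ∣                       ≤⟨ count-mono split ⟩
    ∣ N[ A ∖ ｛ w ｝ ] ⟦ R ⟧ ∪ ｛ w ｝ ∣      ≤⟨ count-∪ M ⟩
    ∣ N[ A ∖ ｛ w ｝ ] ⟦ R ⟧ ∣ + ∣ ｛ w ｝ ∣  ≤⟨ +-monoʳ-≤ _ (count-singleton M w) ⟩
    ∣ N[ A ∖ ｛ w ｝ ] ⟦ R ⟧ ∣ + 1          ≡⟨ +-comm _ 1 ⟩
    suc ∣ N[ A ∖ ｛ w ｝ ] ⟦ R ⟧ ∣          ∎)
    where
    open ≤-Reasoning
    R⊆L : ⟦ R ⟧ ⊆ L
    R⊆L Rv = proj₁ (R⊆L-u Rv)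
    ∣R∣<∣L∣ : ∣ ⟦ R ⟧ ∣ < ∣ L ∣
    ∣R∣<∣L∣ = count-⊂ R⊆L u<M Lu (λ Ru → proj₂ (R⊆L-u Ru) refl)
    loose : ¬ ∣ N[ A ] ⟦ R ⟧ ∣ ≤ ∣ ⟦ R ⟧ ∣
    loose tight = ¬critical (R , R⊆L , n≢0⇒n>0 ∣R∣≢0 , ∣R∣<∣L∣ , tight)
    split : N[ A ] ⟦ R ⟧ ⊆ N[ A ∖ ｛ w ｝ ] ⟦ R ⟧ ∪ ｛ w ｝
    split {w′} (Aw′ , edge) with w ≟ w′
    ... | yes w≡w′ = inj₂ w≡w′
    ... | no w≢w′  = inj₁ ((Aw′ , w≢w′) , edge)

  neighbour : ∀ {L A u} → HallCondition L A → L u → u < M → ∃ λ x → A (e u x)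
  neighbour {L} {A} {u} hallLA Lu u<M
    with count-witness {P = N[ A ] ⟦ u ≡ᵇ_ ⟧} (≤-trans (count-pos {P = ⟦ u ≡ᵇ_ ⟧} u<M (≡⇒≡ᵇ u u refl))
                                (hallLA (u ≡ᵇ_) (λ {v} u≡ᵇv → subst L (≡ᵇ⇒≡ u v u≡ᵇv) Lu)))
  ... | _ , _ , Aw , v , x , u≡ᵇv , refl with ≡ᵇ⇒≡ u v u≡ᵇv
  ... | refl = x , Aw

  HallBelow : ℕ → Set₁
  HallBelow k = ∀ L A → ∣ L ∣ < k → Bounded L → HallCondition L A → Matching L A

  split-at-critical : ∀ {L A} → HallBelow ∣ L ∣ → Bounded L → HallCondition L A → Critical L A → Matching L A
  split-at-critical {L} {A} ih L<M hallLA (S , S⊆L , ∣S∣>0 , ∣S∣<∣L∣ , tight) =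
    matching-mono cover [ proj₁ , proj₁ ]′ (matching-∪ (λ NSw A∖NSw → proj₂ A∖NSw NSw) inside outside)
    where
    inside : Matching ⟦ S ⟧ (N[ A ] ⟦ S ⟧)
    inside = matching-into-N (ih ⟦ S ⟧ A ∣S∣<∣L∣ (λ Sv → L<M (S⊆L Sv)) (hall-condition-⊆ S⊆L hallLA))
    ∣L∖S∣<∣L∣ : ∣ L ∖ ⟦ S ⟧ ∣ < ∣ L ∣
    ∣L∖S∣<∣L∣ with count-witness ∣S∣>0
    ... | u , u<M , Su = count-⊂ proj₁ u<M (S⊆L Su) (λ L∖Su → proj₂ L∖Su Su)
    outside : Matching (L ∖ ⟦ S ⟧) (A ∖ N[ A ] ⟦ S ⟧)
    outside = ih _ _ ∣L∖S∣<∣L∣ (λ L∖Sv → L<M (proj₁ L∖Sv)) (hall-condition-off-critical S hallLA S⊆L tight)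
    cover : L ⊆ ⟦ S ⟧ ∪ (L ∖ ⟦ S ⟧)
    cover {v} Lv with T? (S v)
    ... | yes Sv = inj₁ Sv
    ... | no ¬Sv = inj₂ (Lv , ¬Sv)

  extend-at-point : ∀ {L A u} → HallBelow ∣ L ∣ → Bounded L → HallCondition L A → ¬ Critical L A → L u →
                    Matching L A
  extend-at-point {L} {A} {u} ih L<M hallLA ¬critical Lu with neighbour hallLA Lu (L<M Lu)
  ... | x , Aeux =
    matching-mono cover (λ { (inj₁ refl) → Aeux ; (inj₂ A-w) → proj₁ A-w })
      (matching-∪ (λ { refl A-w → proj₂ A-w refl }) (matching-singleton u x) rest)
    where
    rest : Matching (L ∖ ｛ u ｝) (A ∖ ｛ e u x ｝)
    rest = ih _ _ (count-⊂ proj₁ (L<M Lu) Lu (λ L-u[u] → proj₂ L-u[u] refl)) (λ L-u[v] → L<M (proj₁ L-u[v]))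
              (hall-condition-off-point (e u x) hallLA ¬critical Lu (L<M Lu))
    cover : L ⊆ ｛ u ｝ ∪ (L ∖ ｛ u ｝)
    cover {v} Lv with u ≟ v
    ... | yes u≡v = inj₁ u≡v
    ... | no u≢v  = inj₂ (Lv , u≢v)

  hall-step : ∀ {L A} → HallBelow ∣ L ∣ → Bounded L → HallCondition L A → Matching L A
  hall-step {L} {A} ih L<M hallLA with em {Satisfiable L} | em {Critical L A}
  ... | no L-empty   | _           = matching-empty (λ Lv → L-empty (_ , Lv))
  ... | yes _        | yes critical = split-at-critical ih L<M hallLA critical
  ... | yes (_ , Lu) | no ¬critical = extend-at-point ih L<M hallLA ¬critical Lu

  hall-below : ∀ k → HallBelow k
  hall-below zero _ _ ()
  hall-below (suc k) L A ∣L∣<1+k =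
    hall-step (λ L′ A′ ∣L′∣<∣L∣ → hall-below k L′ A′ (<-≤-trans ∣L′∣<∣L∣ (s≤s⁻¹ ∣L∣<1+k)))

  hall : ∀ L A → Bounded L → HallCondition L A → Matching L A
  hall L A = hall-below (suc ∣ L ∣) L A ≤-refl

module Compactness (em : ExcludedMiddle 0ℓ) {C : Set} (choices : List C) (∈-choices : ∀ x → x ∈ choices)
  (P : ℕ → (ℕ → C) → Set)
  (P-local : ∀ {N c c′} → (∀ {i} → i < N → c i ≡ c′ i) → P N c → P N c′)
  (P-antitone : ∀ {N N′ c} → N ≤ N′ → P N′ c → P N c)
  (solvable : ∀ N → ∃ (P N)) where

  AgreeBelow : ℕ → (ℕ → C) → (ℕ → C) → Set
  AgreeBelow k d c = ∀ {i} → i < k → c i ≡ d i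

  Extendable : ℕ → (ℕ → C) → Set
  Extendable k d = ∀ N → ∃ λ c → P N c × AgreeBelow k d c

  Obstructed : ℕ → (ℕ → C) → ℕ → Set
  Obstructed k d N = ¬ (∃ λ c → P N c × AgreeBelow k d c)

  obstructed-mono : ∀ {k d N N′} → N ≤ N′ → Obstructed k d N → Obstructed k d N′
  obstructed-mono N≤N′ obstructed (c , Pc , agree) = obstructed (c , P-antitone N≤N′ Pc , agree)

  ¬extendable⇒obstructed : ∀ {k d} → ¬ Extendable k d → ∃ (Obstructed k d)
  ¬extendable⇒obstructed {k} {d} ¬extendable with em {∃ (Obstructed k d)}
  ... | yes obstruction = obstruction
  ... | no ¬obstruction =
    ⊥-elim (¬extendable λ N → decidable-stable em λ none → ¬obstruction (N , none))

  _[_≔_] : (ℕ → C) → ℕ → C → ℕ → C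
  (d [ k ≔ x ]) i with i ≟ k
  ... | yes _ = x
  ... | no _  = d i

  update-≢ : ∀ {d k x i} → i ≢ k → (d [ k ≔ x ]) i ≡ d i
  update-≢ {k = k} {i = i} i≢k with i ≟ k
  ... | yes i≡k = contradiction i≡k i≢k
  ... | no _    = refl

  agree-update : ∀ {k d c} → AgreeBelow k d c → AgreeBelow (suc k) (d [ k ≔ c k ]) c
  agree-update {k} agree {i} i<1+k with i ≟ k
  ... | yes refl = refl
  ... | no i≢k   = agree (≤∧≢⇒< (s≤s⁻¹ i<1+k) i≢k)

  extendable-step : ∀ {k d} → Extendable k d → ∃ λ x → Extendable (suc k) (d [ k ≔ x ])
  extendable-step {k} {d} extendable with em {∃ λ x → Extendable (suc k) (d [ k ≔ x ])}
  ... | yes step = step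
  ... | no ¬step
    with common-bound (λ x → Obstructed (suc k) (d [ k ≔ x ])) (λ N≤N′ → obstructed-mono N≤N′) choices
                      (λ x → ¬extendable⇒obstructed λ extendable′ → ¬step (x , extendable′))
  ... | N , obstructed with extendable N
  ... | c , Pc , agree = ⊥-elim (obstructed (∈-choices (c k)) (c , Pc , agree-update agree))

  extension : ∀ k → ∃ (Extendable k)
  extension zero = proj₁ (solvable 0) , λ N → proj₁ (solvable N) , proj₂ (solvable N) , λ ()
  extension (suc k) = extend (extension k)
    where
    extend : ∃ (Extendable k) → ∃ (Extendable (suc k))
    extend (d , extendable) = let x , extendable′ = extendable-step extendable in d [ k ≔ x ] , extendable′

  limit : ℕ → C
  limit i = proj₁ (extension (suc i)) i

  extension-stable : ∀ {i k} → i < k → proj₁ (extension k) i ≡ limit i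
  extension-stable {i} {suc k} i<1+k with m<1+n⇒m<n∨m≡n i<1+k
  ... | inj₂ refl = refl
  ... | inj₁ i<k  = trans (update-≢ (<⇒≢ i<k)) (extension-stable i<k)

  compactness : ∃ λ c → ∀ N → P N c
  compactness = limit , solution
    where
    solution : ∀ N → P N limit
    solution N = let c , Pc , agree = proj₂ (extension N) N in
      P-local (λ i<N → trans (agree i<N) (extension-stable i<N)) Pc

module PermutationAlong (em : ExcludedMiddle 0ℓ) {Z : Set} (c : Z → Z)
  (c-injective : ∀ {m n} → c m ≡ c n → m ≡ n) where

  data Even : Z → Set
  data Odd : Z → Set

  data Even where
    initial   : ∀ {n} → ¬ (∃ λ m → c m ≡ n) → Even n
    after-odd : ∀ {m n} → Odd m → c m ≡ n → Even n

  data Odd where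
    after-even : ∀ {m n} → Even m → c m ≡ n → Odd n

  even-odd-disjoint : ∀ {n} → Even n → Odd n → ⊥
  even-odd-disjoint (initial n∉c[Z]) (after-even {m} _ cm≡n) = n∉c[Z] (m , cm≡n)
  even-odd-disjoint (after-odd odd cm≡n) (after-even even cm′≡n) with c-injective (trans cm≡n (sym cm′≡n))
  ... | refl = even-odd-disjoint even odd

  even-image⇒odd : ∀ {m} → Even (c m) → Odd m
  even-image⇒odd {m} (initial cm∉c[Z]) = ⊥-elim (cm∉c[Z] (m , refl))
  even-image⇒odd (after-odd odd cm′≡cm) with c-injective cm′≡cm
  ... | refl = odd

  predecessor : ∀ {n} → Odd n → Z
  predecessor (after-even {m} _ _) = m

  c-predecessor : ∀ {n} (odd : Odd n) → c (predecessor odd) ≡ n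
  c-predecessor (after-even _ cm≡n) = cm≡n

  predecessor-even : ∀ {n} (odd : Odd n) → Even (predecessor odd)
  predecessor-even (after-even even _) = even

  -- σ swaps the two ends of each edge n → c n with Even n, and follows c elsewhere.
  σ : Z → Z
  σ n with em {Odd n}
  ... | yes odd = predecessor odd
  ... | no _    = c n

  σ-along-c : ∀ n → σ n ≡ c n ⊎ c (σ n) ≡ n
  σ-along-c n with em {Odd n}
  ... | yes odd = inj₂ (c-predecessor odd)
  ... | no _    = inj₁ refl

  σ-not-odd : ∀ {n} → ¬ Odd n → σ n ≡ c n
  σ-not-odd {n} ¬odd with em {Odd n}
  ... | yes odd = contradiction odd ¬odd
  ... | no _    = refl

  σ-after-even : ∀ {n} → Even n → σ (c n) ≡ n
  σ-after-even {n} even with em {Odd (c n)}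
  ... | yes odd = c-injective (c-predecessor odd)
  ... | no ¬odd = contradiction (after-even even refl) ¬odd

  σ-injective : ∀ {n n′} → σ n ≡ σ n′ → n ≡ n′
  σ-injective {n} {n′} eq with em {Odd n} | em {Odd n′}
  ... | yes odd | yes odd′ = trans (sym (c-predecessor odd)) (trans (cong c eq) (c-predecessor odd′))
  ... | no _    | no _     = c-injective eq
  ... | yes odd | no ¬odd′ = contradiction (even-image⇒odd (subst Even eq (predecessor-even odd))) ¬odd′
  ... | no ¬odd | yes odd′ = contradiction (even-image⇒odd (subst Even (sym eq) (predecessor-even odd′))) ¬odd

  σ-surjective : ∀ y → ∃ λ x → σ x ≡ y
  σ-surjective y with em {Odd y}
  ... | yes (after-even {m} even cm≡y) = m , trans (σ-not-odd (even-odd-disjoint even)) cm≡y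
  ... | no ¬odd with em {∃ λ m → c m ≡ y}
  ... | no y∉c[Z] = c y , σ-after-even (initial y∉c[Z])
  ... | yes (m , cm≡y) with em {Odd m}
  ... | yes odd-m = c y , σ-after-even (after-odd odd-m cm≡y)
  ... | no ¬odd-m = m , trans (σ-not-odd ¬odd-m) cm≡y

  permutation-along : Σ (Sym Z) λ π → ∀ n → app π n ≡ c n ⊎ c (app π n) ≡ n
  permutation-along = mk↔ₛ′ σ (λ y → proj₁ (σ-surjective y)) (λ y → proj₂ (σ-surjective y))
                            (λ x → σ-injective (proj₂ (σ-surjective (σ x))))
                    , σ-along-c

InjectiveBelow : {Y : Set} → ℕ → (ℕ → Y) → Set
InjectiveBelow N f = ∀ {v v′} → v < N → v′ < N → f v ≡ f v′ → v ≡ v′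

Adapted : {C : Set} → (ℕ × C → ℕ × C) → Sym ℕ → Set
Adapted φ σ = ∀ m → (∃ λ x → proj₁ (φ (m , x)) ≡ app σ m) ⊎ (∃ λ x → proj₁ (φ (app σ m , x)) ≡ m)

module AdaptedPermutation (em : ExcludedMiddle 0ℓ) {C : Set} {s : ℕ} (enum : C ↔ Fin s) (x₀ : C)
  (φ : ℕ × C → ℕ × C) (φ-injective : ∀ {p q} → φ p ≡ φ q → p ≡ q) where
  open Enumeration enum
  open Counting em

  e : ℕ → C → ℕ
  e v x = proj₁ (φ (v , x))

  length-×elements : (xs : List ℕ) → length (cartesianProduct xs elements) ≡ length xs * s
  length-×elements xs = trans (length-cartesianProduct xs elements) (cong (length xs *_) length-elements)

  module _ (M : ℕ) where
    open Hall em x₀ e M using (N[_])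

    hall-condition : (S : Pred ℕ 0ℓ) → (∀ {v} x → S v → e v x < M) → count M S ≤ count M (N[ U ] S)
    hall-condition S S-closed =
      *-cancelʳ-≤ (count M S) (count M (N[ U ] S)) s ⦃ nonZeroIndex (Inverse.to enum x₀) ⦄ (begin
        count M S * s           ≡⟨ length-×elements (elementsBelow M S) ⟨
        length S×C              ≡⟨ length-map φ S×C ⟨
        length (map φ S×C)      ≤⟨ unique-⊆⇒length≤ image-unique image-⊆ ⟩
        length N[S]×C           ≡⟨ length-×elements (elementsBelow M (N[ U ] S)) ⟩
        count M (N[ U ] S) * s  ∎)
      where
      open ≤-Reasoning
      S×C N[S]×C : List (ℕ × C)
      S×C = cartesianProduct (elementsBelow M S) elements
      N[S]×C = cartesianProduct (elementsBelow M (N[ U ] S)) elements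
      image-unique : Unique (map φ S×C)
      image-unique =
        Unique.map⁺ φ-injective (Unique.cartesianProduct⁺ (elementsBelow-unique M S) elements-unique)
      image-⊆ : ∀ {q} → q ∈ map φ S×C → q ∈ N[S]×C
      image-⊆ q∈ with ∈-map⁻ φ q∈
      ... | (v , x) , vx∈ , refl with ∈-cartesianProduct⁻ (elementsBelow M S) elements vx∈
      ... | v∈S , _ = let Sv = proj₂ (∈-elementsBelow⁻ v∈S) in
        ∈-cartesianProduct⁺ (∈-elementsBelow⁺ (S-closed x Sv) (tt , v , x , Sv , refl)) (∈-elements _)

  height : ℕ × C → ℕ
  height (v , x) = v ⊔ e v x

  injective-below : ∀ N → ∃ λ c → InjectiveBelow N (λ v → e v (c v))
  injective-below N with common-bound (λ p M → height p < M) (λ m≤n h<m → <-≤-trans h<m m≤n)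
                                      (cartesianProduct (upTo N) elements) (λ p → suc (height p) , ≤-refl)
  ... | M , bounded = Matching.choice matching , Matching.injective matching
    where
    open Hall em x₀ e M
    height<M : ∀ {v} x → v < N → v ⊔ e v x < M
    height<M x v<N = bounded (∈-cartesianProduct⁺ (∈-upTo⁺ v<N) (∈-elements x))
    matching : Matching (_< N) U
    matching = hall (_< N) U (λ v<N → ≤-<-trans (m≤m⊔n _ _) (height<M x₀ v<N)) λ S S<N →
      hall-condition M ⟦ S ⟧ (λ x Sv → ≤-<-trans (m≤n⊔m _ _) (height<M x (S<N Sv)))

  saturating-choice : ∃ λ c → ∀ {v v′} → e v (c v) ≡ e v′ (c v′) → v ≡ v′
  saturating-choice = proj₁ compactness , λ {v} {v′} →
    proj₂ compactness (suc (v ⊔ v′)) (s≤s (m≤m⊔n v v′)) (s≤s (m≤n⊔m v v′))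
    where
    respects-agreement : ∀ {N} {c c′ : ℕ → C} → (∀ {i} → i < N → c i ≡ c′ i) → InjectiveBelow N (λ v → e v (c v)) →
            InjectiveBelow N (λ v → e v (c′ v))
    respects-agreement c≡c′ injective {v} {v′} v<N v′<N eq =
      injective v<N v′<N (trans (cong (e v) (c≡c′ v<N)) (trans eq (cong (e v′) (sym (c≡c′ v′<N)))))
    open Compactness em elements ∈-elements (λ N c → InjectiveBelow N (λ v → e v (c v))) respects-agreement
                     (λ N≤N′ injective v<N v′<N → injective (<-≤-trans v<N N≤N′) (<-≤-trans v′<N N≤N′))
                     injective-below

  adapted-permutation : Σ (Sym ℕ) (Adapted φ)
  adapted-permutation =
    let c , c-injective = saturating-choice
        σ , along = PermutationAlong.permutation-along em (λ v → e v (c v)) c-injective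
    in σ , λ m → Sum.map (λ σm≡ → c m , sym σm≡) (λ ≡m → c (app σ m) , ≡m) (along m)

module ProductGroup (em : ExcludedMiddle 0ℓ) (G : Sym ℕ → Set) (isSubgroup : IsSubgroup G)
  (cofinitary : ∀ g → G g → ¬ IsIdentity g → Finite (FixedPoints (app g))) (maximal : MaximalED G)
  (F : Group 0ℓ 0ℓ) (≈⇒≡ : ∀ {x y} → Group._≈_ F x y → x ≡ y) {s : ℕ} (enum : Group.Carrier F ↔ Fin s) where
  open Group F using (_∙_; ε; _//_) renaming (Carrier to C)
  open ProductAction F ≈⇒≡
  open Enumeration enum

  fixedPoints-finite : ∀ (g : Sym ℕ) (f : C) → G g → ¬ (IsIdentity g × f ≡ ε) →
                       Finite (FixedPoints (act g f))
  fixedPoints-finite g f Gg nontrivial with em {IsIdentity g}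
  ... | yes g-id = [] , λ { (m , x) fixed →
          ⊥-elim (nontrivial (g-id , ≈⇒≡ (identityˡ-unique F f x (Group.reflexive F (cong proj₂ fixed))))) }
  ... | no g-not-id with cofinitary g Gg g-not-id
  ... | ms , fixed⊆ms = cartesianProduct ms elements , λ { (m , x) fixed →
          ∈-cartesianProduct⁺ (fixed⊆ms m (cong proj₁ fixed)) (∈-elements x) }

  Induced : Sym (ℕ × C) → Set
  Induced p = Σ (Sym ℕ) λ g → Σ C λ f → G g × (∀ z → app p z ≡ act g f z)

  InducedAgreeing : Sym (ℕ × C) → Set
  InducedAgreeing h = Σ (Sym (ℕ × C)) λ p → Induced p × Infinite (Agree (app h) (app p))

  y//x∙x≡y : ∀ x y → (y // x) ∙ x ≡ y
  y//x∙x≡y x y = ≈⇒≡ (//-rightDividesˡ F x y)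

  module _ (h : Sym (ℕ × C)) (a : Sym ℕ) (Ga : G a) where

    Forward Backward : C → C → ℕ → Set
    Forward x y m = app h (m , x) ≡ (app a m , y)
    Backward x y m = app h (app a m , x) ≡ (m , y)

    forward-agreement : ∀ {x y} → Infinite (Forward x y) → InducedAgreeing h
    forward-agreement {x} {y} infinite = induced a (y // x) , (a , y // x , Ga , λ _ → refl) , λ finite →
      infinite (finite-⊆-image proj₁ (λ {m} forward →
        (m , x) , trans forward (cong (app a m ,_) (sym (y//x∙x≡y x y))) , refl) finite)

    backward-agreement : ∀ {x y} → Infinite (Backward x y) → InducedAgreeing h
    backward-agreement {x} {y} infinite with IsSubgroup.has-inv isSubgroup a Ga
    ... | r , Gr , r∘a≡id = induced r (y // x) , (r , y // x , Gr , λ _ → refl) , λ finite →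
      infinite (finite-⊆-image (app r ∘ proj₁) (λ {m} backward →
        (app a m , x) , trans backward (cong₂ _,_ (sym (r∘a≡id m)) (sym (y//x∙x≡y x y))) , r∘a≡id m) finite)

    Pattern : Bool × C × C → ℕ → Set
    Pattern (true , x , y)  = Forward x y
    Pattern (false , x , y) = Backward x y

    patterns : List (Bool × C × C)
    patterns = cartesianProduct (true ∷ false ∷ []) (cartesianProduct elements elements)

    ∈-patterns : ∀ b x y → (b , x , y) ∈ patterns
    ∈-patterns b x y = ∈-cartesianProduct⁺ (∈-bools b) (∈-cartesianProduct⁺ (∈-elements x) (∈-elements y))
      where
      ∈-bools : ∀ b → b ∈ true ∷ false ∷ []
      ∈-bools true  = here refl
      ∈-bools false = there (here refl)

    pattern-cover : ∀ {σ} → Adapted (app h) σ → ∀ {m} → Agree (app σ) (app a) m →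
                    ∃ λ κ → κ ∈ patterns × Pattern κ m
    pattern-cover adapted {m} σm≡am with adapted m
    ... | inj₁ (x , hmx≡σm) = (true , x , _) , ∈-patterns true x _ ,
          cong (_, proj₂ (app h (m , x))) (trans hmx≡σm σm≡am)
    ... | inj₂ (x , hσmx≡m) = (false , x , _) , ∈-patterns false x _ ,
          cong (_, proj₂ (app h (app a m , x))) (subst (λ n → proj₁ (app h (n , x)) ≡ m) σm≡am hσmx≡m)

  maximalED : MaximalED Induced
  maximalED h = agreement
    (infinite-pigeonhole em (Pattern h a Ga) (patterns h a Ga) (pattern-cover h a Ga {σ} adapted) σ≈a)
    where
    adapted-h : Σ (Sym ℕ) (Adapted (app h))
    adapted-h = AdaptedPermutation.adapted-permutation em enum ε (app h) (Injection.injective (↔⇒↣ h))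
    σ : Sym ℕ
    σ = proj₁ adapted-h
    adapted : Adapted (app h) σ
    adapted = proj₂ adapted-h
    a : Sym ℕ
    a = proj₁ (maximal σ)
    Ga : G a
    Ga = proj₁ (proj₂ (maximal σ))
    σ≈a : Infinite (Agree (app σ) (app a))
    σ≈a = proj₂ (proj₂ (maximal σ))
    agreement : (∃ λ κ → Infinite (Pattern h a Ga κ)) → InducedAgreeing h
    agreement ((true , _ , _) , infinite)  = forward-agreement h a Ga infinite
    agreement ((false , _ , _) , infinite) = backward-agreement h a Ga infinite

mainTheorem4 : ExcludedMiddle 0ℓ →
    (G : Sym ℕ → Set) → IsCofinitaryGroup G → MaximalED G →
    (F : Group 0ℓ 0ℓ) → (fin : IsFiniteGroup F) →
    let open ProductAction F (proj₁ fin) in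
    (∀ (g : Sym ℕ) (f : Group.Carrier F) → G g →
       ¬ (IsIdentity g × f ≡ Group.ε F) →
       Finite (FixedPoints (act g f)))
    × MaximalED (λ (p : Sym (ℕ × Group.Carrier F)) →
         Σ (Sym ℕ) λ g → Σ (Group.Carrier F) λ f →
           G g × (∀ z → app p z ≡ act g f z))
mainTheorem4 em G (isSubgroup , cofinitary) maximal F (≈⇒≡ , _ , enum) = fixedPoints-finite , maximalED
  where open ProductGroup em G isSubgroup cofinitary maximal F ≈⇒≡ enum
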